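{- Let $t$ be a positive integer and let $G$ be a finite simple graph of order $n = 4t-1$ with independence number $\alpha(G) = 2$ and $\operatorname{cm}(G) \le t-1$. If there is a collection consisting of $k_1$ single vertices and $k_2$ edges of $G$, all pairwise vertex-disjoint, which is pairwise connected, then $k_1 + k_2 \le \operatorname{cm}(G)$.
   Context: $\alpha(G)$ is the independence number of $G$. Each single vertex is regarded as a one-vertex subgraph and each edge as the subgraph consisting of the edge and its two endpoints. Two vertex-disjoint subgraphs $H, H'$ of $G$ are called connected if there are vertices $u \in H$, $v \in H'$ with $uv \in E(G)$; a collection is pairwise connected if every two of its members are connected. A connected matching is a pairwise connected collection of pairwise vertex-disjoint edges, and $\operatorname{cm}(G)$ denotes the maximum size of a connected matching in $G$. -}

module Defs where

open import Level using (0ℓ)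
open import Data.Nat using (ℕ; _≤_)
open import Data.Fin using (Fin)
open import Data.Product using (_×_; _,_; ∃; ∃-syntax)
open import Data.List using (List; []; _∷_; length; filter)
open import Data.List.Membership.Propositional using (_∈_)
open import Data.List.Relation.Unary.All using (All)
open import Data.List.Relation.Unary.AllPairs using (AllPairs)
open import Data.List.Relation.Unary.Unique.Propositional using (Unique)
open import Relation.Binary.PropositionalEquality using (_≡_)
open import Relation.Nullary using (¬_; Dec)
open import Relation.Unary using (Decidable)

record Graph (n : ℕ) : Set₁ where
  field
    E      : Fin n → Fin n → Set
    E-sym  : ∀ {u v} → E u v → E v u
    E-irr  : ∀ {u} → ¬ E u u
    E-dec  : ∀ u v → Dec (E u v)
open Graph public

module _ {n : ℕ} (G : Graph n) where

  IsIndependent : List (Fin n) → Set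
  IsIndependent S = Unique S × AllPairs (λ u v → ¬ E G u v) S

  IndependenceNumber : ℕ → Set
  IndependenceNumber a =
    (∃[ S ] (IsIndependent S × length S ≡ a)) ×
    (∀ S → IsIndependent S → length S ≤ a)

  data Piece : Set where
    vtx : Fin n → Piece
    edg : (u v : Fin n) → E G u v → Piece

  verts : Piece → List (Fin n)
  verts (vtx v)     = v ∷ []
  verts (edg u v _) = u ∷ v ∷ []

  VertexDisjoint : Piece → Piece → Set
  VertexDisjoint H H' = ∀ {x} → x ∈ verts H → ¬ (x ∈ verts H')

  Connected : Piece → Piece → Set
  Connected H H' = ∃[ u ] ∃[ v ] (u ∈ verts H × v ∈ verts H' × E G u v)

  IsPairwiseConnectedCollection : List Piece → Set
  IsPairwiseConnectedCollection C =
    AllPairs (λ H H' → VertexDisjoint H H' × Connected H H') C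

  isVtx : Piece → Set
  isVtx (vtx _)     = ⊤' where open import Data.Unit using () renaming (⊤ to ⊤')
  isVtx (edg _ _ _) = ⊥' where open import Data.Empty using () renaming (⊥ to ⊥')

  isEdg : Piece → Set
  isEdg (vtx _)     = ⊥' where open import Data.Empty using () renaming (⊥ to ⊥')
  isEdg (edg _ _ _) = ⊤' where open import Data.Unit using () renaming (⊤ to ⊤')

  isVtx? : Decidable isVtx
  isVtx? (vtx _)     = Relation.Nullary.yes _ where import Relation.Nullary
  isVtx? (edg _ _ _) = Relation.Nullary.no (λ ()) where import Relation.Nullary

  isEdg? : Decidable isEdg
  isEdg? (vtx _)     = Relation.Nullary.no (λ ()) where import Relation.Nullary
  isEdg? (edg _ _ _) = Relation.Nullary.yes _ where import Relation.Nullary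

  numVertices : List Piece → ℕ
  numVertices C = length (filter isVtx? C)

  numEdges : List Piece → ℕ
  numEdges C = length (filter isEdg? C)

  IsConnectedMatching : List Piece → Set
  IsConnectedMatching M = All isEdg M × IsPairwiseConnectedCollection M

  ConnectedMatchingNumber : ℕ → Set
  ConnectedMatchingNumber c =
    (∃[ M ] (IsConnectedMatching M × length M ≡ c)) ×
    (∀ M → IsConnectedMatching M → length M ≤ c)

{-# OPTIONS --safe #-}
-- Suppose C had cm + 1 pieces. Turn them one by one into edges: an edge is kept, and a single
-- vertex v is joined to a neighbour r among the vertices not used so far. The new edge stays
-- connected to every other piece because it contains v, and disjoint from them because r was
-- unused. If every single vertex finds such a neighbour, the result is a connected matching of
-- size cm + 1. Otherwise some v has no neighbour among the unused vertices, of which there are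
-- at least n - 2(cm + 1) + 1 ≥ 2cm + 2; since α(G) = 2 they form a clique, and a clique on
-- 2cm + 2 vertices contains a connected matching of size cm + 1 as well.
module Submission where

open import Defs
open import Data.Nat using (ℕ; zero; suc; _+_; _*_; _∸_; _≤_; _<_; z≤n; s≤s; _≤?_)
open import Data.Nat.Properties
open import Data.Nat.Solver using (module +-*-Solver)
open import Data.Fin using (Fin)
open import Data.Fin.Properties using () renaming (_≟_ to _≟ᶠ_)
open import Data.List using (List; []; _∷_; length; filter; take; allFin; concatMap)
open import Data.List.Properties using (filter-all; filter-accept; filter-reject; length-take; length-tabulate)
open import Data.List.Relation.Unary.All as All using (All; []; _∷_)
open import Data.List.Relation.Unary.All.Properties using (All¬⇒¬Any; ¬Any⇒All¬)
open import Data.List.Relation.Unary.Any using (any?)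
open import Data.List.Relation.Unary.AllPairs as AllPairs using (AllPairs; []; _∷_)
import Data.List.Relation.Unary.AllPairs.Properties as AllPairsₚ
open import Data.List.Relation.Unary.Unique.Propositional using (Unique)
import Data.List.Relation.Unary.Unique.Propositional.Properties as Unique
open import Data.List.Relation.Binary.Disjoint.Propositional using (Disjoint)
open import Data.List.Relation.Binary.Subset.Propositional using (_⊆_)
open import Data.List.Membership.Propositional using (_∈_; _∉_; find)
open import Data.List.Membership.Propositional.Properties using (∈-filter⁻; ∈-++⁺ˡ; ∈-++⁺ʳ)
open import Data.List.Relation.Unary.Any using (here; there)
open import Data.Product using (_×_; _,_; ∃-syntax; proj₁; proj₂)
open import Data.Empty using (⊥; ⊥-elim)
open import Data.Unit using (tt)
open import Function using (_∘_; id)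
open import Relation.Unary using (Decidable)
open import Relation.Binary.Definitions using (DecidableEquality)
open import Relation.Binary.PropositionalEquality using (_≡_; refl; sym; trans; cong; subst)
open import Relation.Nullary using (¬_; Dec; yes; no; ¬?; contradiction)

module Removal {a} {A : Set a} (_≟_ : DecidableEquality A) where

  differs? : ∀ x → Decidable (λ y → ¬ y ≡ x)
  differs? x y = ¬? (y ≟ x)

  remove : A → List A → List A
  remove x = filter (differs? x)

  ∈-remove⁻ : ∀ {x y} xs → y ∈ remove x xs → y ∈ xs × ¬ y ≡ x
  ∈-remove⁻ {x} xs = ∈-filter⁻ (differs? x)

  remove-unique : ∀ {x xs} → Unique xs → Unique (remove x xs)
  remove-unique {x} = Unique.filter⁺ (differs? x)

  length-remove : ∀ x {xs} → Unique xs → length xs ≤ suc (length (remove x xs))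
  length-remove x {[]} _ = z≤n
  length-remove x {y ∷ ys} (y∉ys ∷ ys-unique) = by-cases (y ≟ x)
    where
      by-cases : Dec (y ≡ x) → length (y ∷ ys) ≤ suc (length (remove x (y ∷ ys)))
      by-cases (no y≢x) =
        subst (λ zs → length (y ∷ ys) ≤ suc (length zs)) (sym (filter-accept (differs? x) y≢x))
          (s≤s (length-remove x ys-unique))
      -- Only y itself is dropped: by uniqueness no other entry of the list equals x.
      by-cases (yes y≡x) = ≤-reflexive (cong (suc ∘ length) (sym (begin
        remove x (y ∷ ys)  ≡⟨ filter-reject (differs? x) (λ y≢x → y≢x y≡x) ⟩
        remove x ys        ≡⟨ filter-all (differs? x) (All.map (λ y≢z z≡x → y≢z (trans y≡x (sym z≡x))) y∉ys) ⟩
        ys                 ∎)))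
        where open Relation.Binary.PropositionalEquality.≡-Reasoning

  removeAll : List A → List A → List A
  removeAll []       xs = xs
  removeAll (y ∷ ys) xs = remove y (removeAll ys xs)

  ∈-removeAll⁻ : ∀ {x} ys xs → x ∈ removeAll ys xs → x ∈ xs × x ∉ ys
  ∈-removeAll⁻ []       xs x∈ = x∈ , λ ()
  ∈-removeAll⁻ (y ∷ ys) xs x∈ with ∈-remove⁻ (removeAll ys xs) x∈
  ... | x∈′ , x≢y with ∈-removeAll⁻ ys xs x∈′
  ... | x∈xs , x∉ys = x∈xs , λ { (here x≡y) → x≢y x≡y ; (there x∈ys) → x∉ys x∈ys }

  removeAll-unique : ∀ ys {xs} → Unique xs → Unique (removeAll ys xs)
  removeAll-unique []       u = u
  removeAll-unique (y ∷ ys) u = remove-unique (removeAll-unique ys u)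

  length-removeAll : ∀ ys {xs} → Unique xs → length xs ≤ length (removeAll ys xs) + length ys
  length-removeAll []       {xs} _ = ≤-reflexive (sym (+-identityʳ (length xs)))
  length-removeAll (y ∷ ys) {xs} u = begin
    length xs                                              ≤⟨ length-removeAll ys u ⟩
    length (removeAll ys xs) + length ys                   ≤⟨ +-monoˡ-≤ _ (length-remove y (removeAll-unique ys u)) ⟩
    suc (length (remove y (removeAll ys xs))) + length ys  ≡⟨ sym (+-suc _ _) ⟩
    length (removeAll (y ∷ ys) xs) + length (y ∷ ys)       ∎
    where open ≤-Reasoning

module _ {n : ℕ} (G : Graph n) where

  open Removal (_≟ᶠ_ {n})

  Linked : Piece G → Piece G → Set
  Linked H H' = VertexDisjoint G H H' × Connected G H H'

  Linked-sym : ∀ {H H'} → Linked H H' → Linked H' H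
  Linked-sym (disjoint , (u , v , u∈ , v∈ , uv)) =
    (λ x∈H' x∈H → disjoint x∈H x∈H') , (v , u , v∈ , u∈ , E-sym G uv)

  Linked-grow : ∀ {v r H} (e : E G v r) → r ∉ verts G H → Linked (vtx v) H → Linked (edg v r e) H
  Linked-grow e r∉H (disjoint , (u , w , here refl , w∈H , uw)) =
    (λ { (here refl) → disjoint (here refl) ; (there (here refl)) → r∉H ; (there (there ())) })
    , (u , w , here refl , w∈H , uw)

  verts-nonempty : ∀ H → ∃[ x ] x ∈ verts G H
  verts-nonempty (vtx x)     = x , here refl
  verts-nonempty (edg x _ _) = x , here refl

  vertices : List (Piece G) → List (Fin n)
  vertices = concatMap (verts G)

  length-vertices+numVertices : ∀ C → length (vertices C) + numVertices G C ≡ 2 * length C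
  length-vertices+numVertices []              = refl
  length-vertices+numVertices (vtx v ∷ C)     = begin
    suc (length (vertices C) + suc (numVertices G C))  ≡⟨ cong suc (+-suc _ _) ⟩
    suc (suc (length (vertices C) + numVertices G C))  ≡⟨ cong (suc ∘ suc) (length-vertices+numVertices C) ⟩
    suc (suc (2 * length C))                           ≡⟨ sym (*-suc 2 (length C)) ⟩
    2 * length (vtx v ∷ C)                             ∎
    where open Relation.Binary.PropositionalEquality.≡-Reasoning
  length-vertices+numVertices (edg _ _ _ ∷ C) =
    trans (cong (suc ∘ suc) (length-vertices+numVertices C)) (sym (*-suc 2 (length C)))

  numVertices+numEdges : ∀ C → numVertices G C + numEdges G C ≡ length C
  numVertices+numEdges []              = refl
  numVertices+numEdges (vtx _ ∷ C)     = cong suc (numVertices+numEdges C)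
  numVertices+numEdges (edg _ _ _ ∷ C) = trans (+-suc _ _) (cong suc (numVertices+numEdges C))

  length-removeAll-allFin : ∀ xs → n ≤ length (removeAll xs (allFin n)) + length xs
  length-removeAll-allFin xs =
    subst (_≤ length (removeAll xs (allFin n)) + length xs) (length-tabulate id)
      (length-removeAll xs (Unique.allFin⁺ n))

  Disjoint-vertices⁻ : ∀ {R} C → Disjoint R (vertices C) → All (λ H → Disjoint R (verts G H)) C
  Disjoint-vertices⁻ []      _        = []
  Disjoint-vertices⁻ (H ∷ C) disjoint =
    (λ (x∈R , x∈H) → disjoint (x∈R , ∈-++⁺ˡ x∈H))
    ∷ Disjoint-vertices⁻ C (λ (x∈R , x∈C) → disjoint (x∈R , ∈-++⁺ʳ (verts G H) x∈C))

  IsClique : List (Fin n) → Set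
  IsClique R = ∀ {x y} → x ∈ R → y ∈ R → ¬ x ≡ y → E G x y

  clique-matching : ∀ k R → Unique R → IsClique R → 2 * k ≤ length R →
    ∃[ M ] (IsConnectedMatching G M × length M ≡ k × All (λ H → verts G H ⊆ R) M)
  clique-matching zero    R               _ _ _ = [] , ([] , []) , refl , []
  clique-matching (suc k) []              _ _ ()
  clique-matching (suc k) (_ ∷ [])        _ _ 2k+2≤1 =
    contradiction (subst (_≤ 1) (*-suc 2 k) 2k+2≤1) λ { (s≤s ()) }
  clique-matching (suc k) (a ∷ b ∷ R) ((a≢b ∷ a≢R) ∷ (b≢R ∷ unique)) clique 2k+2≤
    with clique-matching k R unique (λ x∈R y∈R → clique (there (there x∈R)) (there (there y∈R)))
           (≤-pred (≤-pred (subst (_≤ 2 + length R) (*-suc 2 k) 2k+2≤)))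
  ... | M , (edges , pairwise) , |M| , inside =
    (edg a b ab ∷ M) , ((tt ∷ edges) , (All.map joins inside ∷ pairwise)) , cong suc |M| ,
    ((λ { (here refl) → here refl ; (there (here refl)) → there (here refl) ; (there (there ())) })
     ∷ All.map widen inside)
    where
      ab : E G a b
      ab = clique (here refl) (there (here refl)) a≢b
      a∉R : a ∉ R
      a∉R = All¬⇒¬Any a≢R
      b∉R : b ∉ R
      b∉R = All¬⇒¬Any b≢R
      widen : ∀ {H} → verts G H ⊆ R → verts G H ⊆ a ∷ b ∷ R
      widen H⊆R x∈H = there (there (H⊆R x∈H))
      joins : ∀ {H} → verts G H ⊆ R → Linked (edg a b ab) H
      joins {H} H⊆R with verts-nonempty H
      ... | c , c∈H =
        (λ { (here refl) x∈H → a∉R (H⊆R x∈H)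
           ; (there (here refl)) x∈H → b∉R (H⊆R x∈H)
           ; (there (there ())) _ })
        , (a , c , here refl , c∈H , clique (here refl) (there (there (H⊆R c∈H))) λ { refl → a∉R (H⊆R c∈H) })

  -- D holds the edges built so far, C the pieces still to process and R the unused vertices.
  -- The budget is invariant since R loses a vertex exactly when a single vertex of C becomes an edge.
  module Greedy (k b : ℕ) where

    record Configuration (D C : List (Piece G)) (R : List (Fin n)) : Set where
      field
        edges       : All (isEdg G) D
        pairwise    : AllPairs Linked D
        pending     : AllPairs Linked C
        across      : All (λ H → All (Linked H) C) D
        free-unique : Unique R
        free-D      : All (λ H → Disjoint R (verts G H)) D
        free-C      : All (λ H → Disjoint R (verts G H)) C
        size        : length D + length C ≡ k
        budget      : b + numVertices G C ≤ length R

    data Outcome : Set where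
      matched : ∀ M → IsConnectedMatching G M → length M ≡ k → Outcome
      stuck   : ∀ v R → Unique R → v ∉ R → All (λ x → ¬ E G v x) R → b < length R → Outcome

    take-edge : ∀ {D C R u w} {e : E G u w} →
                Configuration D (edg u w e ∷ C) R → Configuration (edg u w e ∷ D) C R
    take-edge {u = u} {w = w} {e = e} cfg = record
      { edges       = tt ∷ edges
      ; pairwise    = All.map (Linked-sym {H' = edg u w e}) (All.map All.head across) ∷ pairwise
      ; pending     = AllPairs.tail pending
      ; across      = AllPairs.head pending ∷ All.map All.tail across
      ; free-unique = free-unique
      ; free-D      = All.head free-C ∷ free-D
      ; free-C      = All.tail free-C
      ; size        = trans (sym (+-suc _ _)) size
      ; budget      = budget
      }
      where open Configuration cfg

    grow-vertex : ∀ {D C R v r} → Configuration D (vtx v ∷ C) R → r ∈ R → (e : E G v r) →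
                  Configuration (edg v r e ∷ D) C (remove r R)
    grow-vertex {D} {C} {R} {v} {r} cfg r∈R e = record
      { edges       = tt ∷ edges
      ; pairwise    = All.zipWith grow-D (All.map All.head across , free-D) ∷ pairwise
      ; pending     = AllPairs.tail pending
      ; across      = All.zipWith grow-C (AllPairs.head pending , All.tail free-C) ∷ All.map All.tail across
      ; free-unique = remove-unique free-unique
      ; free-D      = new-free ∷ All.map shrink free-D
      ; free-C      = All.map shrink (All.tail free-C)
      ; size        = trans (sym (+-suc _ _)) size
      ; budget      = ≤-pred (≤-trans (subst (_≤ length R) (+-suc b _) budget) (length-remove r free-unique))
      }
      where
        open Configuration cfg
        r∉ : ∀ {H} → Disjoint R (verts G H) → r ∉ verts G H
        r∉ free r∈H = free (r∈R , r∈H)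
        grow-D : ∀ {H} → Linked H (vtx v) × Disjoint R (verts G H) → Linked (edg v r e) H
        grow-D (linked , free) = Linked-grow e (r∉ free) (Linked-sym {H' = vtx v} linked)
        grow-C : ∀ {H} → Linked (vtx v) H × Disjoint R (verts G H) → Linked (edg v r e) H
        grow-C (linked , free) = Linked-grow e (r∉ free) linked
        shrink : ∀ {H} → Disjoint R (verts G H) → Disjoint (remove r R) (verts G H)
        shrink free (x∈ , x∈H) = free (proj₁ (∈-remove⁻ R x∈) , x∈H)
        new-free : Disjoint (remove r R) (v ∷ r ∷ [])
        new-free (x∈ , here refl)         = All.head free-C (proj₁ (∈-remove⁻ R x∈) , here refl)
        new-free (x∈ , there (here refl)) = proj₂ (∈-remove⁻ R x∈) refl

    greedy : ∀ D C R → Configuration D C R → Outcome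
    greedy D [] R cfg = matched D (edges , pairwise) (trans (sym (+-identityʳ _)) size)
      where open Configuration cfg
    greedy D (edg u w e ∷ C) R cfg = greedy (edg u w e ∷ D) C R (take-edge cfg)
    greedy D (vtx v ∷ C) R cfg with any? (E-dec G v) R
    ... | yes neighbour with find neighbour
    ...   | r , r∈R , vr = greedy (edg v r vr ∷ D) C (remove r R) (grow-vertex cfg r∈R vr)
    greedy D (vtx v ∷ C) R cfg | no none =
      stuck v R free-unique (λ v∈R → All.head free-C (v∈R , here refl)) (¬Any⇒All¬ R none)
        (≤-trans (s≤s (m≤m+n b _)) (subst (_≤ length R) (+-suc b _) budget))
      where open Configuration cfg

  module _ (α≤2 : ∀ S → IsIndependent G S → length S ≤ 2) where

    nonNeighbours-clique : ∀ {v R} → v ∉ R → All (λ x → ¬ E G v x) R → IsClique R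
    nonNeighbours-clique {v} {R} v∉R nonAdjacent {x} {y} x∈R y∈R x≢y with E-dec G x y
    ... | yes xy = xy
    ... | no ¬xy = contradiction (α≤2 (v ∷ x ∷ y ∷ []) (distinct , independent)) λ { (s≤s (s≤s ())) }
      where
        distinct : Unique (v ∷ x ∷ y ∷ [])
        distinct = ((λ { refl → v∉R x∈R }) ∷ (λ { refl → v∉R y∈R }) ∷ []) ∷ (x≢y ∷ []) ∷ [] ∷ []
        independent : AllPairs (λ u w → ¬ E G u w) (v ∷ x ∷ y ∷ [])
        independent = (All.lookup nonAdjacent x∈R ∷ All.lookup nonAdjacent y∈R ∷ []) ∷ (¬xy ∷ []) ∷ [] ∷ []

    module _ (cm : ℕ) (cm-max : ∀ M → IsConnectedMatching G M → length M ≤ cm)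
             (order : 3 + 4 * cm ≤ n) where

      open Greedy (suc cm) (suc (2 * cm))

      no-matching-of-size-suc-cm : ∀ M → IsConnectedMatching G M → length M ≡ suc cm → ⊥
      no-matching-of-size-suc-cm M matching |M| = 1+n≰n (subst (_≤ cm) |M| (cm-max M matching))

      initial-budget : ∀ C (R : List (Fin n)) → length (vertices C) + numVertices G C ≡ 2 * suc cm →
                       n ≤ length R + length (vertices C) → suc (2 * cm) + numVertices G C ≤ length R
      initial-budget C R count covered =
        +-cancelʳ-≤ (length (vertices C)) (suc (2 * cm) + numVertices G C) (length R) (begin
        suc (2 * cm) + numVertices G C + length (vertices C)    ≡⟨ +-assoc (suc (2 * cm)) _ _ ⟩
        suc (2 * cm) + (numVertices G C + length (vertices C))  ≡⟨ cong (suc (2 * cm) +_) (trans (+-comm (numVertices G C) _) count) ⟩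
        suc (2 * cm) + 2 * suc cm                               ≡⟨ solve 1 (λ c → (con 1 :+ con 2 :* c) :+ con 2 :* (con 1 :+ c)
                                                                                  := con 3 :+ con 4 :* c) refl cm ⟩
        3 + 4 * cm                                              ≤⟨ order ⟩
        n                                                       ≤⟨ covered ⟩
        length R + length (vertices C)                          ∎)
        where
          open ≤-Reasoning
          open +-*-Solver

      initial-configuration : ∀ C → AllPairs Linked C → length C ≡ suc cm →
                              Configuration [] C (removeAll (vertices C) (allFin n))
      initial-configuration C linked |C| = record
        { edges       = []
        ; pairwise    = []
        ; pending     = linked
        ; across      = []
        ; free-unique = removeAll-unique (vertices C) (Unique.allFin⁺ n)
        ; free-D      = []
        ; free-C      = Disjoint-vertices⁻ C λ (x∈ , x∈C) → proj₂ (∈-removeAll⁻ (vertices C) (allFin n) x∈) x∈C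
        ; size        = |C|
        ; budget      = initial-budget C (removeAll (vertices C) (allFin n))
                          (trans (length-vertices+numVertices C) (cong (2 *_) |C|))
                          (length-removeAll-allFin (vertices C))
        }

      no-collection-of-size-suc-cm : ∀ C → AllPairs Linked C → length C ≡ suc cm → ⊥
      no-collection-of-size-suc-cm C linked |C|
        with greedy [] C (removeAll (vertices C) (allFin n)) (initial-configuration C linked |C|)
      ... | matched M matching |M| = no-matching-of-size-suc-cm M matching |M|
      ... | stuck v R unique v∉R nonAdjacent 2cm+1<|R|
        with clique-matching (suc cm) R unique (nonNeighbours-clique v∉R nonAdjacent)
               (subst (_≤ length R) (sym (*-suc 2 cm)) 2cm+1<|R|)
      ...   | M , matching , |M| , _ = no-matching-of-size-suc-cm M matching |M|

      collection-bounded : ∀ C → AllPairs Linked C → length C ≤ cm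
      collection-bounded C linked with length C ≤? cm
      ... | yes |C|≤cm = |C|≤cm
      ... | no  |C|≰cm = ⊥-elim (no-collection-of-size-suc-cm (take (suc cm) C)
                                  (AllPairsₚ.take⁺ (suc cm) linked)
                                  (trans (length-take (suc cm) C) (m≤n⇒m⊓n≡m (≰⇒> |C|≰cm))))

order-bound : ∀ t cm → 1 ≤ t → cm ≤ t ∸ 1 → 3 + 4 * cm ≤ 4 * t ∸ 1
order-bound (suc t) cm _ cm≤t = begin
  3 + 4 * cm     ≤⟨ +-monoʳ-≤ 3 (*-monoʳ-≤ 4 cm≤t) ⟩
  3 + 4 * t      ≡⟨ cong (_∸ 1) (sym (*-suc 4 t)) ⟩
  4 * suc t ∸ 1  ∎
  where open ≤-Reasoning

lemma2 : (t n : ℕ) → 1 ≤ t → n ≡ 4 * t ∸ 1 → (G : Graph n) →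
         IndependenceNumber G 2 →
         (cm : ℕ) → ConnectedMatchingNumber G cm → cm ≤ t ∸ 1 →
         (C : List (Piece G)) → IsPairwiseConnectedCollection G C →
         numVertices G C + numEdges G C ≤ cm
lemma2 t n 1≤t refl G (_ , α≤2) cm (_ , cm-max) cm≤t C linked = begin
  numVertices G C + numEdges G C  ≡⟨ numVertices+numEdges G C ⟩
  length C                        ≤⟨ collection-bounded G α≤2 cm cm-max (order-bound t cm 1≤t cm≤t) C linked ⟩
  cm                              ∎
  where open ≤-Reasoning
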